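{- Let $G$ be a graph with $G\notin\mathcal{G}^{\rm SSP}$. Then: (1) the tensor product $G\times H$ is not in $\mathcal{G}^{\rm SSP}$ for any graph $H$; (2) for any integer $m\geq 1$, the corona graph $G\odot K_{m-1}^c$ is not in $\mathcal{G}^{\rm SSP}$.
   Context: All graphs are finite, simple and undirected. For a graph $G$ on vertex set $\{1,\dots,n\}$, $\mathcal{S}(G)$ denotes the set of real symmetric $n\times n$ matrices $A=[a_{ij}]$ such that for $i\neq j$, $a_{ij}\neq 0$ if and only if $\{i,j\}\in E(G)$ (diagonal entries unrestricted). A real symmetric matrix $A$ has the strong spectral property (SSP) if the only real symmetric matrix $X$ satisfying $A\circ X=0$, $I\circ X=0$ and $AX-XA=0$ is $X=0$ (entrywise product $\circ$). $\mathcal{G}^{\rm SSP}$ denotes the set of all graphs $G$ such that every matrix in $\mathcal{S}(G)$ has the SSP. The tensor product $G\times H$ has vertex set $V(G)\times V(H)$, with $(u,u')$ adjacent to $(v,v')$ iff $\{u,v\}\in E(G)$ and $\{u',v'\}\in E(H)$. $K_{m-1}^c$ is the edgeless graph on $m-1$ vertices. If $V(G)=\{v_1,\dots,v_n\}$, the corona $G\odot H$ is obtained by taking $G$ and $n$ copies of $H$ and joining, for each $i$, the vertex $v_i$ to every vertex of the $i$-th copy of $H$. -}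

module Defs where

open import Level using (Level; 0ℓ) renaming (suc to lsuc)
open import Data.Nat as ℕ using (ℕ; zero; suc; _∸_)
open import Data.Fin using (Fin; zero; suc; splitAt; remQuot; combine)
open import Data.Fin.Properties using (_≟_)
open import Data.Bool using (Bool; true; false; _∧_)
open import Data.Sum using (_⊎_; inj₁; inj₂)
open import Data.Product using (_×_; _,_; Σ; ∃; proj₁; proj₂)
open import Data.Empty using (⊥)
open import Relation.Nullary using (¬_; ⌊_⌋)
open import Relation.Binary.PropositionalEquality using (_≡_; _≢_)
open import Algebra.Structures using (IsCommutativeRing)

-- The real numbers, axiomatised as a complete ordered field
-- (unique up to isomorphism; the statement quantifies over any model).

record RealField : Set₁ where
  infixl 6 _+_
  infixl 7 _*_
  infix  4 _<_ _≤_
  field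
    ℝ   : Set
    _+_ _*_ : ℝ → ℝ → ℝ
    -_  : ℝ → ℝ
    0ℝ 1ℝ : ℝ
    isCommutativeRing : IsCommutativeRing _≡_ _+_ _*_ -_ 0ℝ 1ℝ
    0≢1 : 0ℝ ≢ 1ℝ
    inverse : ∀ x → x ≢ 0ℝ → Σ ℝ λ y → x * y ≡ 1ℝ
    _<_ : ℝ → ℝ → Set
    <-irrefl : ∀ x → ¬ (x < x)
    <-trans : ∀ {x y z} → x < y → y < z → x < z
    <-trichotomy : ∀ x y → x < y ⊎ (x ≡ y ⊎ y < x)
    +-mono-< : ∀ {x y} z → x < y → x + z < y + z
    *-pos : ∀ {x y} → 0ℝ < x → 0ℝ < y → 0ℝ < x * y
  _≤_ : ℝ → ℝ → Set
  x ≤ y = x < y ⊎ x ≡ y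
  UpperBound : (ℝ → Set) → ℝ → Set
  UpperBound P b = ∀ x → P x → x ≤ b
  field
    completeness : (P : ℝ → Set) → ∃ P → ∃ (UpperBound P) →
                   Σ ℝ λ s → UpperBound P s × (∀ b → UpperBound P b → s ≤ b)

record Graph : Set where
  field
    n       : ℕ
    adj     : Fin n → Fin n → Bool
    adj-sym : ∀ i j → adj i j ≡ adj j i
    adj-irr : ∀ i → adj i i ≡ false

open Graph public

edgeless : ℕ → Graph
edgeless k = record { n = k ; adj = λ _ _ → false
                    ; adj-sym = λ _ _ → _≡_.refl ; adj-irr = λ _ → _≡_.refl }

-- tensor product; vertex (u,u') is encoded as combine u u'
-- (equivalently decoded by remQuot)
tensorAdj : (G H : Graph) → Fin (n G ℕ.* n H) → Fin (n G ℕ.* n H) → Bool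
tensorAdj G H p q =
  adj G (proj₁ (remQuot {n G} (n H) p)) (proj₁ (remQuot {n G} (n H) q))
  ∧ adj H (proj₂ (remQuot {n G} (n H) p)) (proj₂ (remQuot {n G} (n H) q))

-- corona G ⊙ H: vertices Fin (n G + n G * n H); the left part is G,
-- remQuot gives (i , k) in the right part = vertex k of the i-th copy of H.
coronaAdj' : (G H : Graph) → Fin (n G) ⊎ Fin (n G ℕ.* n H) → Fin (n G) ⊎ Fin (n G ℕ.* n H) → Bool
coronaAdj' G H (inj₁ u) (inj₁ v) = adj G u v
coronaAdj' G H (inj₁ u) (inj₂ d) = ⌊ u ≟ proj₁ (remQuot {n G} (n H) d) ⌋
coronaAdj' G H (inj₂ c) (inj₁ v) = ⌊ proj₁ (remQuot {n G} (n H) c) ≟ v ⌋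
coronaAdj' G H (inj₂ c) (inj₂ d) =
  ⌊ proj₁ (remQuot {n G} (n H) c) ≟ proj₁ (remQuot {n G} (n H) d) ⌋
  ∧ adj H (proj₂ (remQuot {n G} (n H) c)) (proj₂ (remQuot {n G} (n H) d))

coronaAdj : (G H : Graph) → Fin (n G ℕ.+ n G ℕ.* n H) → Fin (n G ℕ.+ n G ℕ.* n H) → Bool
coronaAdj G H p q = coronaAdj' G H (splitAt (n G) p) (splitAt (n G) q)

module _ (R : RealField) where
  open RealField R

  Matrix : ℕ → Set
  Matrix m = Fin m → Fin m → ℝ

  Σℝ : ∀ {m} → (Fin m → ℝ) → ℝ
  Σℝ {zero}  f = 0ℝ
  Σℝ {suc m} f = f zero + Σℝ (λ i → f (suc i))

  mmul : ∀ {m} → Matrix m → Matrix m → Matrix m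
  mmul A B i j = Σℝ (λ k → A i k * B k j)

  Symmetric : ∀ {m} → Matrix m → Set
  Symmetric A = ∀ i j → A i j ≡ A j i

  InS : (G : Graph) → Matrix (n G) → Set
  InS G A = Symmetric A ×
            (∀ i j → i ≢ j → (A i j ≢ 0ℝ → adj G i j ≡ true) × (adj G i j ≡ true → A i j ≢ 0ℝ))

  SSP : ∀ {m} → Matrix m → Set
  SSP {m} A = (X : Matrix m) → Symmetric X →
              (∀ i j → A i j * X i j ≡ 0ℝ) →
              (∀ i → X i i ≡ 0ℝ) →
              (∀ i j → mmul A X i j ≡ mmul X A i j) →
              ∀ i j → X i j ≡ 0ℝ

  InGSSP : Graph → Set
  InGSSP G = (A : Matrix (n G)) → InS G A → SSP A

tensor : Graph → Graph → Graph
tensor G H = record { n = n G ℕ.* n H ; adj = tensorAdj G H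
                    ; adj-sym = λ p q → cong₂ _∧_ (adj-sym G (proj₁ (remQuot {n G} (n H) p)) _) (adj-sym H (proj₂ (remQuot {n G} (n H) p)) _)
                    ; adj-irr = λ p → cong (_∧ adj H (proj₂ (remQuot {n G} (n H) p)) (proj₂ (remQuot {n G} (n H) p))) (adj-irr G (proj₁ (remQuot {n G} (n H) p))) }
  where open import Relation.Binary.PropositionalEquality using (cong; cong₂)

corona : Graph → Graph → Graph
corona G H = record { n = n G ℕ.+ n G ℕ.* n H ; adj = coronaAdj G H
                    ; adj-sym = λ p q → sym' (splitAt (n G) p) (splitAt (n G) q)
                    ; adj-irr = λ p → irr' (splitAt (n G) p) }
  where
  open import Relation.Binary.PropositionalEquality using (refl; cong; cong₂; sym)
  open import Relation.Nullary using (yes; no)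
  open import Data.Empty using (⊥-elim)
  eqsym : ∀ {k} (i j : Fin k) → ⌊ i ≟ j ⌋ ≡ ⌊ j ≟ i ⌋
  eqsym i j with i ≟ j | j ≟ i
  ... | yes _ | yes _ = refl
  ... | no _ | no _ = refl
  ... | yes e | no ne = ⊥-elim (ne (sym e))
  ... | no ne | yes e = ⊥-elim (ne (sym e))
  sym' : ∀ x y → coronaAdj' G H x y ≡ coronaAdj' G H y x
  sym' (inj₁ u) (inj₁ v) = adj-sym G u v
  sym' (inj₁ u) (inj₂ d) = eqsym u (proj₁ (remQuot {n G} (n H) d))
  sym' (inj₂ c) (inj₁ v) = eqsym (proj₁ (remQuot {n G} (n H) c)) v
  sym' (inj₂ c) (inj₂ d) = cong₂ _∧_ (eqsym (proj₁ (remQuot {n G} (n H) c)) (proj₁ (remQuot {n G} (n H) d))) (adj-sym H (proj₂ (remQuot {n G} (n H) c)) (proj₂ (remQuot {n G} (n H) d)))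
  irr' : ∀ x → coronaAdj' G H x x ≡ false
  irr' (inj₁ u) = adj-irr G u
  irr' (inj₂ c) = trans (cong (⌊ proj₁ (remQuot {n G} (n H) c) ≟ proj₁ (remQuot {n G} (n H) c) ⌋ ∧_) (adj-irr H (proj₂ (remQuot {n G} (n H) c)))) (∧-zeroʳ _)
    where open import Data.Bool.Properties using (∧-zeroʳ)
          open import Relation.Binary.PropositionalEquality using (trans)

-- Let A ∈ S(G) fail the SSP, witnessed by X ≠ 0. For G × H pick a weighted adjacency matrix B of H with an
-- eigenpair B x = c x, x_w ≠ 0, and replace each off-diagonal entry A_uv by the block A_uv B and each diagonal
-- entry A_uu by A_uu c I: since B and c I both act on x xᵀ as multiplication by c, the nonzero matrix X ⊗ x xᵀ
-- witnesses the failure of the SSP for the new matrix in S(G × H). A suitable B is D^(-1/2) Adj D^(-1/2), with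
-- eigenvector D^(1/2) 1; the square roots exist by completeness. For the corona, join every pendant vertex to
-- its vertex of G with weight 1 and put 0 between pendant vertices; then [[X, 0], [0, X ⊗ I]] is a witness.
module Submission where

open import Defs
open import Algebra.Bundles using (CommutativeRing)
open import Data.Bool using (Bool; true; false; _∧_; if_then_else_)
open import Data.Bool.Properties using (∧-zeroʳ; ∧-conicalˡ; ∧-conicalʳ)
open import Data.Empty using (⊥-elim)
open import Data.Fin
  using (Fin; zero; suc; combine; remQuot; quotient; remainder; splitAt; _↑ˡ_; _↑ʳ_; join; fromℕ<)
open import Data.Fin.Properties
  using (_≟_; suc-injective; remQuot-combine; combine-remQuot; splitAt-↑ˡ; splitAt-↑ʳ; join-splitAt)
open import Data.Nat as ℕ using (ℕ; _∸_)
open import Data.Product using (Σ; _×_; _,_; proj₁; proj₂; uncurry)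
open import Data.Sum using (_⊎_; inj₁; inj₂)
open import Relation.Binary.Definitions using (Decidable)
open import Relation.Binary.PropositionalEquality
open import Relation.Nullary using (¬_; Dec; yes; no; ⌊_⌋)
import Algebra.Solver.Ring.NaturalCoefficients.Default as SemiringSolver
import Algebra.Properties.Ring as RingProperties

module _ (R : RealField) where
  open RealField R

  commutativeRing : CommutativeRing _ _
  commutativeRing = record { isCommutativeRing = isCommutativeRing }

  open CommutativeRing commutativeRing
    using (+-assoc; +-comm; *-assoc; *-comm; +-identityˡ; +-identityʳ; *-identityˡ; *-identityʳ;
           zeroˡ; zeroʳ; distribˡ; -‿inverseʳ)
  open SemiringSolver (CommutativeRing.commutativeSemiring commutativeRing)
    using (solve; _:+_; _:*_; _:=_)
  open RingProperties (CommutativeRing.ring commutativeRing)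
    using (-‿distribˡ-*; -‿distribʳ-*; -‿involutive)

  -- Ordered fields

  <⇒≢ : ∀ {x y} → x < y → x ≢ y
  <⇒≢ {y = y} x<y refl = <-irrefl y x<y

  0<⇒≢0 : ∀ {x} → 0ℝ < x → x ≢ 0ℝ
  0<⇒≢0 0<x x≡0 = <⇒≢ 0<x (sym x≡0)

  infix 4 _≟ℝ_
  _≟ℝ_ : Decidable (_≡_ {A = ℝ})
  x ≟ℝ y with <-trichotomy x y
  ... | inj₁ x<y        = no (<⇒≢ x<y)
  ... | inj₂ (inj₁ x≡y) = yes x≡y
  ... | inj₂ (inj₂ y<x) = no (λ x≡y → <⇒≢ y<x (sym x≡y))

  <-≤-trans : ∀ {x y z} → x < y → y ≤ z → x < z
  <-≤-trans x<y (inj₁ y<z) = <-trans x<y y<z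
  <-≤-trans x<y (inj₂ refl) = x<y

  ≤-<-trans : ∀ {x y z} → x ≤ y → y < z → x < z
  ≤-<-trans (inj₁ x<y) y<z = <-trans x<y y<z
  ≤-<-trans (inj₂ refl) y<z = y<z

  +-monoʳ-< : ∀ {x y} z → x < y → z + x < z + y
  +-monoʳ-< {x} {y} z x<y = subst₂ _<_ (+-comm x z) (+-comm y z) (+-mono-< z x<y)

  x<x+y : ∀ x {y} → 0ℝ < y → x < x + y
  x<x+y x 0<y = subst (_< x + _) (+-identityʳ x) (+-monoʳ-< x 0<y)

  x≤x+y : ∀ x {y} → 0ℝ ≤ y → x ≤ x + y
  x≤x+y x (inj₁ 0<y) = inj₁ (x<x+y x 0<y)
  x≤x+y x (inj₂ refl) = inj₂ (sym (+-identityʳ x))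

  <⇒positiveDifference : ∀ {x y} → x < y → Σ ℝ λ d → 0ℝ < d × x + d ≡ y
  <⇒positiveDifference {x} {y} x<y =
    y + - x ,
    subst (_< y + - x) (-‿inverseʳ x) (+-mono-< (- x) x<y) ,
    (begin
      x + (y + - x)  ≡⟨ cong (x +_) (+-comm y (- x)) ⟩
      x + (- x + y)  ≡⟨ sym (+-assoc x (- x) y) ⟩
      x + - x + y    ≡⟨ cong (_+ y) (-‿inverseʳ x) ⟩
      0ℝ + y         ≡⟨ +-identityˡ y ⟩
      y              ∎)
    where open ≡-Reasoning

  neg-pos : ∀ {x} → x < 0ℝ → 0ℝ < - x
  neg-pos {x} x<0 = subst (_< - x) (-‿inverseʳ x) (subst (x + - x <_) (+-identityˡ (- x)) (+-mono-< (- x) x<0))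

  +-pos : ∀ {x y} → 0ℝ < x → 0ℝ ≤ y → 0ℝ < x + y
  +-pos {x} 0<x 0≤y = <-≤-trans 0<x (x≤x+y x 0≤y)

  +-nonneg : ∀ {x y} → 0ℝ ≤ x → 0ℝ ≤ y → 0ℝ ≤ x + y
  +-nonneg (inj₁ 0<x) 0≤y = inj₁ (+-pos 0<x 0≤y)
  +-nonneg {y = y} (inj₂ refl) 0≤y = subst (0ℝ ≤_) (sym (+-identityˡ y)) 0≤y

  *-monoˡ-< : ∀ {c x y} → 0ℝ < c → x < y → c * x < c * y
  *-monoˡ-< {c} {x} 0<c x<y with <⇒positiveDifference x<y
  ... | d , 0<d , refl = subst (c * x <_) (sym (distribˡ c x d)) (x<x+y (c * x) (*-pos 0<c 0<d))

  *-monoʳ-< : ∀ {c x y} → 0ℝ < c → x < y → x * c < y * c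
  *-monoʳ-< {c} {x} {y} 0<c x<y = subst₂ _<_ (*-comm c x) (*-comm c y) (*-monoˡ-< 0<c x<y)

  *-self-< : ∀ {x y} → 0ℝ ≤ x → x < y → x * x < y * y
  *-self-< {x} {y} 0≤x x<y = ≤-<-trans (x*x≤x*y 0≤x) (*-monoʳ-< (≤-<-trans 0≤x x<y) x<y)
    where
    x*x≤x*y : 0ℝ ≤ x → x * x ≤ x * y
    x*x≤x*y (inj₁ 0<x) = inj₁ (*-monoˡ-< 0<x x<y)
    x*x≤x*y (inj₂ refl) = inj₂ (trans (zeroˡ 0ℝ) (sym (zeroˡ y)))

  -x*-x : ∀ x → - x * - x ≡ x * x
  -x*-x x = begin
    - x * - x       ≡⟨ sym (-‿distribˡ-* x (- x)) ⟩
    - (x * - x)     ≡⟨ cong -_ (sym (-‿distribʳ-* x x)) ⟩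
    - (- (x * x))   ≡⟨ -‿involutive (x * x) ⟩
    x * x           ∎
    where open ≡-Reasoning

  *-self-pos : ∀ {x} → x ≢ 0ℝ → 0ℝ < x * x
  *-self-pos {x} x≢0 with <-trichotomy x 0ℝ
  ... | inj₁ x<0        = subst (0ℝ <_) (-x*-x x) (*-pos (neg-pos x<0) (neg-pos x<0))
  ... | inj₂ (inj₁ x≡0) = ⊥-elim (x≢0 x≡0)
  ... | inj₂ (inj₂ 0<x) = *-pos 0<x 0<x

  *-self-nonneg : ∀ x → 0ℝ ≤ x * x
  *-self-nonneg x with x ≟ℝ 0ℝ
  ... | yes refl = inj₂ (sym (zeroˡ 0ℝ))
  ... | no x≢0   = inj₁ (*-self-pos x≢0)

  0<1 : 0ℝ < 1ℝ
  0<1 = subst (0ℝ <_) (*-identityˡ 1ℝ) (*-self-pos (λ 1≡0 → 0≢1 (sym 1≡0)))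

  *-nonzero : ∀ {x y} → x ≢ 0ℝ → y ≢ 0ℝ → x * y ≢ 0ℝ
  *-nonzero {x} {y} x≢0 y≢0 xy≡0 with inverse x x≢0
  ... | x⁻¹ , x*x⁻¹≡1 = y≢0 (begin
    y                 ≡⟨ sym (*-identityˡ y) ⟩
    1ℝ * y            ≡⟨ cong (_* y) (sym x*x⁻¹≡1) ⟩
    x * x⁻¹ * y       ≡⟨ x*x⁻¹*y≡x⁻¹*[x*y] x x⁻¹ y ⟩
    x⁻¹ * (x * y)     ≡⟨ cong (x⁻¹ *_) xy≡0 ⟩
    x⁻¹ * 0ℝ          ≡⟨ zeroʳ x⁻¹ ⟩
    0ℝ                ∎)
    where
    open ≡-Reasoning
    x*x⁻¹*y≡x⁻¹*[x*y] : ∀ x x⁻¹ y → x * x⁻¹ * y ≡ x⁻¹ * (x * y)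
    x*x⁻¹*y≡x⁻¹*[x*y] = solve 3 (λ x x⁻¹ y → x :* x⁻¹ :* y := x⁻¹ :* (x :* y)) refl

  *≡0⇒≡0 : ∀ {x y} → x * y ≡ 0ℝ → y ≢ 0ℝ → x ≡ 0ℝ
  *≡0⇒≡0 {x} xy≡0 y≢0 with x ≟ℝ 0ℝ
  ... | yes x≡0 = x≡0
  ... | no x≢0  = ⊥-elim (*-nonzero x≢0 y≢0 xy≡0)

  recip : ℝ → ℝ
  recip x with x ≟ℝ 0ℝ
  ... | yes _   = 0ℝ
  ... | no x≢0  = proj₁ (inverse x x≢0)

  recip-inverse : ∀ {x} → x ≢ 0ℝ → x * recip x ≡ 1ℝ
  recip-inverse {x} x≢0 with x ≟ℝ 0ℝ
  ... | yes x≡0 = ⊥-elim (x≢0 x≡0)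
  ... | no x≢0′ = proj₂ (inverse x x≢0′)

  recip-nonzero : ∀ {x} → x ≢ 0ℝ → recip x ≢ 0ℝ
  recip-nonzero {x} x≢0 recip≡0 =
    0≢1 (trans (sym (zeroʳ x)) (trans (cong (x *_) (sym recip≡0)) (recip-inverse x≢0)))

  recip-pos : ∀ {x} → 0ℝ < x → 0ℝ < recip x
  recip-pos {x} 0<x with <-trichotomy 0ℝ (recip x)
  ... | inj₁ 0<x⁻¹         = 0<x⁻¹
  ... | inj₂ (inj₁ 0≡x⁻¹)  = ⊥-elim (recip-nonzero (0<⇒≢0 0<x) (sym 0≡x⁻¹))
  ... | inj₂ (inj₂ x⁻¹<0)  = ⊥-elim (<-irrefl 0ℝ (<-trans 0<1 (subst (_< 0ℝ) (recip-inverse (0<⇒≢0 0<x))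
                               (subst (x * recip x <_) (zeroʳ x) (*-monoˡ-< 0<x x⁻¹<0)))))

  -- Square roots

  module SquareRoot {a : ℝ} (0<a : 0ℝ < a) where

    SquareBelow : ℝ → Set
    SquareBelow y = y * y < a

    0-squareBelow : SquareBelow 0ℝ
    0-squareBelow = subst (_< a) (sym (zeroˡ 0ℝ)) 0<a

    1+a-upperBound : UpperBound SquareBelow (1ℝ + a)
    1+a-upperBound y y*y<a with <-trichotomy y (1ℝ + a)
    ... | inj₁ y<1+a        = inj₁ y<1+a
    ... | inj₂ (inj₁ y≡1+a) = inj₂ y≡1+a
    ... | inj₂ (inj₂ 1+a<y) = ⊥-elim (<-irrefl a (<-trans a<1+a (<-trans 1+a<[1+a]² (<-trans [1+a]²<y² y*y<a))))
      where
      a<1+a : a < 1ℝ + a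
      a<1+a = subst (a <_) (+-comm a 1ℝ) (x<x+y a 0<1)
      0<1+a : 0ℝ < 1ℝ + a
      0<1+a = +-pos 0<1 (inj₁ 0<a)
      1+a<[1+a]² : 1ℝ + a < (1ℝ + a) * (1ℝ + a)
      1+a<[1+a]² = subst (_< (1ℝ + a) * (1ℝ + a)) (*-identityʳ (1ℝ + a))
                     (*-monoˡ-< 0<1+a (x<x+y 1ℝ 0<a))
      [1+a]²<y² : (1ℝ + a) * (1ℝ + a) < y * y
      [1+a]²<y² = *-self-< (inj₁ 0<1+a) 1+a<y

    module Supremum {s : ℝ} (s-upperBound : UpperBound SquareBelow s)
                    (s-least : ∀ b → UpperBound SquareBelow b → s ≤ b) where

      0≤s : 0ℝ ≤ s
      0≤s = s-upperBound 0ℝ 0-squareBelow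

      -- The step ε = d / (2s + 1 + d) is below 1, so (s + ε)² < s² + ε (2s + 1 + d) = s² + d.
      raise : ∀ {d} → 0ℝ < d → s * s + d ≡ a → Σ ℝ λ ε → 0ℝ < ε × SquareBelow (s + ε)
      raise {d} 0<d s*s+d≡a = ε , 0<ε , subst₂ _<_ (sym ([s+ε]² s ε)) s*s+d≡a (+-monoʳ-< (s * s) ε[2s+ε]<d)
        where
        K : ℝ
        K = s + s + 1ℝ + d
        2s<2s+1 : s + s < s + s + 1ℝ
        2s<2s+1 = x<x+y (s + s) 0<1
        0<2s+1 : 0ℝ < s + s + 1ℝ
        0<2s+1 = ≤-<-trans (+-nonneg 0≤s 0≤s) 2s<2s+1
        d<K : d < K
        d<K = subst (d <_) (+-comm d (s + s + 1ℝ)) (x<x+y d 0<2s+1)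
        0<K : 0ℝ < K
        0<K = <-trans 0<d d<K
        κ : ℝ
        κ = recip K
        0<κ : 0ℝ < κ
        0<κ = recip-pos 0<K
        Kκ≡1 : K * κ ≡ 1ℝ
        Kκ≡1 = recip-inverse (0<⇒≢0 0<K)
        ε : ℝ
        ε = d * κ
        0<ε : 0ℝ < ε
        0<ε = *-pos 0<d 0<κ
        εK≡d : ε * K ≡ d
        εK≡d = trans (*-assoc d κ K) (trans (cong (d *_) (trans (*-comm κ K) Kκ≡1)) (*-identityʳ d))
        ε<1 : ε < 1ℝ
        ε<1 = subst₂ _<_ (*-comm κ d) (trans (*-comm κ K) Kκ≡1)
                (*-monoˡ-< 0<κ d<K)
        ε[2s+ε]<d : ε * (s + s + ε) < d
        ε[2s+ε]<d = subst (ε * (s + s + ε) <_) εK≡d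
                      (*-monoˡ-< 0<ε (<-trans (+-monoʳ-< (s + s) ε<1) (x<x+y (s + s + 1ℝ) 0<d)))
        [s+ε]² : ∀ s ε → (s + ε) * (s + ε) ≡ s * s + ε * (s + s + ε)
        [s+ε]² = solve 2 (λ s ε → (s :+ ε) :* (s :+ ε) := s :* s :+ ε :* (s :+ s :+ ε)) refl

      -- The Newton step b = (s² + a) / 2s satisfies b < s and b² = a + (d / 2s)², where a + d = s².
      lower : ∀ {d} → 0ℝ < d → a + d ≡ s * s → Σ ℝ λ b → b < s × UpperBound SquareBelow b
      lower {d} 0<d a+d≡s*s = b , b<s , b-upperBound
        where
        0<s : 0ℝ < s
        0<s with 0≤s
        ... | inj₁ 0<s = 0<s
        ... | inj₂ 0≡s = ⊥-elim (<-irrefl 0ℝ (<-trans 0<a (subst (a <_) (trans a+d≡s*s s*s≡0) (x<x+y a 0<d))))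
          where
          s*s≡0 : s * s ≡ 0ℝ
          s*s≡0 = trans (cong (λ x → x * x) (sym 0≡s)) (zeroˡ 0ℝ)
        0<2s : 0ℝ < s + s
        0<2s = +-pos 0<s (inj₁ 0<s)
        t : ℝ
        t = recip (s + s)
        0<t : 0ℝ < t
        0<t = recip-pos 0<2s
        2st≡1 : (s + s) * t ≡ 1ℝ
        2st≡1 = recip-inverse (0<⇒≢0 0<2s)
        b : ℝ
        b = (s * s + a) * t
        0<b : 0ℝ < b
        0<b = *-pos (subst (0ℝ <_) (+-comm a (s * s)) (+-pos 0<a (*-self-nonneg s))) 0<t
        b+dt≡s : b + d * t ≡ s
        b+dt≡s = begin
          (s * s + a) * t + d * t   ≡⟨ [x+a]t+dt (s * s) a d t ⟩
          (s * s + (a + d)) * t     ≡⟨ cong (λ x → (s * s + x) * t) a+d≡s*s ⟩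
          (s * s + s * s) * t       ≡⟨ [ss+ss]t s t ⟩
          s * ((s + s) * t)         ≡⟨ cong (s *_) 2st≡1 ⟩
          s * 1ℝ                    ≡⟨ *-identityʳ s ⟩
          s                         ∎
          where
          open ≡-Reasoning
          [x+a]t+dt : ∀ x a d t → (x + a) * t + d * t ≡ (x + (a + d)) * t
          [x+a]t+dt = solve 4 (λ x a d t → (x :+ a) :* t :+ d :* t := (x :+ (a :+ d)) :* t) refl
          [ss+ss]t : ∀ s t → (s * s + s * s) * t ≡ s * ((s + s) * t)
          [ss+ss]t = solve 2 (λ s t → (s :* s :+ s :* s) :* t := s :* ((s :+ s) :* t)) refl
        b<s : b < s
        b<s = subst (b <_) b+dt≡s (x<x+y b (*-pos 0<d 0<t))
        b*b≡a+[dt]² : b * b ≡ a + d * t * (d * t)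
        b*b≡a+[dt]² = begin
          (s * s + a) * t * ((s * s + a) * t)
            ≡⟨ cong (λ x → (x + a) * t * ((x + a) * t)) (sym a+d≡s*s) ⟩
          (a + d + a) * t * ((a + d + a) * t)
            ≡⟨ [2a+d]²t² a d t ⟩
          a * ((a + d) * ((t + t) * (t + t))) + d * t * (d * t)
            ≡⟨ cong (λ x → a * (x * ((t + t) * (t + t))) + d * t * (d * t)) a+d≡s*s ⟩
          a * (s * s * ((t + t) * (t + t))) + d * t * (d * t)
            ≡⟨ cong (λ x → a * x + d * t * (d * t)) ([2st]² s t) ⟩
          a * ((s + s) * t * ((s + s) * t)) + d * t * (d * t)
            ≡⟨ cong (λ x → a * (x * x) + d * t * (d * t)) 2st≡1 ⟩
          a * (1ℝ * 1ℝ) + d * t * (d * t)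
            ≡⟨ cong (λ x → a * x + d * t * (d * t)) (*-identityʳ 1ℝ) ⟩
          a * 1ℝ + d * t * (d * t)
            ≡⟨ cong (_+ d * t * (d * t)) (*-identityʳ a) ⟩
          a + d * t * (d * t)
            ∎
          where
          open ≡-Reasoning
          [2a+d]²t² : ∀ a d t → (a + d + a) * t * ((a + d + a) * t)
                                ≡ a * ((a + d) * ((t + t) * (t + t))) + d * t * (d * t)
          [2a+d]²t² = solve 3 (λ a d t → (a :+ d :+ a) :* t :* ((a :+ d :+ a) :* t)
                                       := a :* ((a :+ d) :* ((t :+ t) :* (t :+ t))) :+ d :* t :* (d :* t)) refl
          [2st]² : ∀ s t → s * s * ((t + t) * (t + t)) ≡ (s + s) * t * ((s + s) * t)
          [2st]² = solve 2 (λ s t → s :* s :* ((t :+ t) :* (t :+ t)) := (s :+ s) :* t :* ((s :+ s) :* t)) refl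
        b-upperBound : UpperBound SquareBelow b
        b-upperBound y y*y<a with <-trichotomy y b
        ... | inj₁ y<b        = inj₁ y<b
        ... | inj₂ (inj₁ y≡b) = inj₂ y≡b
        ... | inj₂ (inj₂ b<y) = ⊥-elim (<-irrefl a (≤-<-trans a≤b*b (<-trans (*-self-< (inj₁ 0<b) b<y) y*y<a)))
          where
          a≤b*b : a ≤ b * b
          a≤b*b = subst (a ≤_) (sym b*b≡a+[dt]²) (x≤x+y a (*-self-nonneg (d * t)))

      s*s≮a : ¬ (s * s < a)
      s*s≮a s*s<a with <⇒positiveDifference s*s<a
      ... | d , 0<d , s*s+d≡a =
        let ε , 0<ε , s+ε-below = raise 0<d s*s+d≡a
        in <-irrefl s (<-≤-trans (x<x+y s 0<ε) (s-upperBound (s + ε) s+ε-below))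

      a≮s*s : ¬ (a < s * s)
      a≮s*s a<s*s with <⇒positiveDifference a<s*s
      ... | d , 0<d , a+d≡s*s =
        let b , b<s , b-upperBound = lower 0<d a+d≡s*s
        in <-irrefl s (≤-<-trans (s-least b b-upperBound) b<s)

      square : s * s ≡ a
      square with <-trichotomy (s * s) a
      ... | inj₁ s*s<a        = ⊥-elim (s*s≮a s*s<a)
      ... | inj₂ (inj₁ s*s≡a) = s*s≡a
      ... | inj₂ (inj₂ a<s*s) = ⊥-elim (a≮s*s a<s*s)

  sqrt : ∀ {a} → 0ℝ ≤ a → Σ ℝ λ s → s * s ≡ a
  sqrt (inj₁ 0<a) with completeness (SquareRoot.SquareBelow 0<a) (0ℝ , SquareRoot.0-squareBelow 0<a)
                                    (1ℝ + _ , SquareRoot.1+a-upperBound 0<a)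
  ... | s , s-upperBound , s-least = s , SquareRoot.Supremum.square 0<a s-upperBound s-least
  sqrt (inj₂ refl) = 0ℝ , zeroˡ 0ℝ

  -- Finite sums

  Σ-cong : ∀ {m} {f g : Fin m → ℝ} → (∀ i → f i ≡ g i) → Σℝ R f ≡ Σℝ R g
  Σ-cong {ℕ.zero}  f≗g = refl
  Σ-cong {ℕ.suc m} f≗g = cong₂ _+_ (f≗g zero) (Σ-cong (λ i → f≗g (suc i)))

  Σ-zero : ∀ {m} {f : Fin m → ℝ} → (∀ i → f i ≡ 0ℝ) → Σℝ R f ≡ 0ℝ
  Σ-zero {ℕ.zero}  f≗0 = refl
  Σ-zero {ℕ.suc m} f≗0 = trans (cong₂ _+_ (f≗0 zero) (Σ-zero (λ i → f≗0 (suc i)))) (+-identityˡ 0ℝ)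

  *-distribˡ-Σ : ∀ {m} c (f : Fin m → ℝ) → c * Σℝ R f ≡ Σℝ R (λ i → c * f i)
  *-distribˡ-Σ {ℕ.zero}  c f = zeroʳ c
  *-distribˡ-Σ {ℕ.suc m} c f =
    trans (distribˡ c (f zero) _) (cong (c * f zero +_) (*-distribˡ-Σ c (λ i → f (suc i))))

  *-distribʳ-Σ : ∀ {m} c (f : Fin m → ℝ) → Σℝ R f * c ≡ Σℝ R (λ i → f i * c)
  *-distribʳ-Σ c f = trans (*-comm _ c) (trans (*-distribˡ-Σ c f) (Σ-cong (λ i → *-comm c (f i))))

  Σ-single : ∀ {m} {f : Fin m → ℝ} i → (∀ j → j ≢ i → f j ≡ 0ℝ) → Σℝ R f ≡ f i
  Σ-single {ℕ.suc m} {f} zero    others≡0 =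
    trans (cong (f zero +_) (Σ-zero (λ j → others≡0 (suc j) (λ ())))) (+-identityʳ (f zero))
  Σ-single {ℕ.suc m} {f} (suc i) others≡0 =
    trans (cong (_+ Σℝ R (λ j → f (suc j))) (others≡0 zero (λ ())))
          (trans (+-identityˡ _)
                 (Σ-single i (λ j j≢i → others≡0 (suc j) (λ sj≡si → j≢i (suc-injective sj≡si)))))

  Σ-nonneg : ∀ {m} {f : Fin m → ℝ} → (∀ i → 0ℝ ≤ f i) → 0ℝ ≤ Σℝ R f
  Σ-nonneg {ℕ.zero}  0≤f = inj₂ refl
  Σ-nonneg {ℕ.suc m} 0≤f = +-nonneg (0≤f zero) (Σ-nonneg (λ i → 0≤f (suc i)))

  Σ-pos : ∀ {m} {f : Fin m → ℝ} → (∀ i → 0ℝ ≤ f i) → ∀ i → 0ℝ < f i → 0ℝ < Σℝ R f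
  Σ-pos 0≤f zero    0<f₀ = +-pos 0<f₀ (Σ-nonneg (λ i → 0≤f (suc i)))
  Σ-pos 0≤f (suc i) 0<fᵢ =
    subst (0ℝ <_) (+-comm _ _) (+-pos (Σ-pos (λ j → 0≤f (suc j)) i 0<fᵢ) (0≤f zero))

  Σ-splitAt : ∀ m {n} (f : Fin (m ℕ.+ n) → ℝ) →
              Σℝ R f ≡ Σℝ R (λ i → f (i ↑ˡ n)) + Σℝ R (λ j → f (m ↑ʳ j))
  Σ-splitAt ℕ.zero    f = sym (+-identityˡ _)
  Σ-splitAt (ℕ.suc m) f = trans (cong (f zero +_) (Σ-splitAt m (λ i → f (suc i)))) (sym (+-assoc _ _ _))

  Σ-splitAt-⊎ : ∀ m {n} (g : Fin m ⊎ Fin n → ℝ) →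
                Σℝ R (λ p → g (splitAt m p)) ≡ Σℝ R (λ i → g (inj₁ i)) + Σℝ R (λ j → g (inj₂ j))
  Σ-splitAt-⊎ m {n} g = trans (Σ-splitAt m (λ p → g (splitAt m p)))
    (cong₂ _+_ (Σ-cong (λ i → cong g (splitAt-↑ˡ m i n))) (Σ-cong (λ j → cong g (splitAt-↑ʳ m n j))))

  Σ-combine : ∀ m {k} (f : Fin (m ℕ.* k) → ℝ) →
              Σℝ R f ≡ Σℝ R (λ (i : Fin m) → Σℝ R (λ (j : Fin k) → f (combine i j)))
  Σ-combine ℕ.zero    f = refl
  Σ-combine (ℕ.suc m) {k} f =
    trans (Σ-splitAt k f) (cong (Σℝ R (λ j → f (j ↑ˡ (m ℕ.* k))) +_) (Σ-combine m (λ p → f (k ↑ʳ p))))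

  Σ-remQuot : ∀ m {k} (g : Fin m × Fin k → ℝ) →
              Σℝ R (λ p → g (remQuot k p)) ≡ Σℝ R (λ i → Σℝ R (λ j → g (i , j)))
  Σ-remQuot m {k} g =
    trans (Σ-combine m (λ p → g (remQuot k p))) (Σ-cong (λ i → Σ-cong (λ j → cong g (remQuot-combine i j))))

  -- Supports, Kronecker delta and block matrices

  NonzeroIff : ℝ → Bool → Set
  NonzeroIff x b = (x ≢ 0ℝ → b ≡ true) × (b ≡ true → x ≢ 0ℝ)

  NonzeroIff-* : ∀ {x y b c} → NonzeroIff x b → NonzeroIff y c → NonzeroIff (x * y) (b ∧ c)
  NonzeroIff-* {x} {y} {b} {c} (x≢0⇒b , b⇒x≢0) (y≢0⇒c , c⇒y≢0) = xy≢0⇒b∧c , b∧c⇒xy≢0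
    where
    xy≢0⇒b∧c : x * y ≢ 0ℝ → b ∧ c ≡ true
    xy≢0⇒b∧c xy≢0 = cong₂ _∧_ (x≢0⇒b (λ x≡0 → xy≢0 (trans (cong (_* y) x≡0) (zeroˡ y))))
                              (y≢0⇒c (λ y≡0 → xy≢0 (trans (cong (x *_) y≡0) (zeroʳ x))))
    b∧c⇒xy≢0 : b ∧ c ≡ true → x * y ≢ 0ℝ
    b∧c⇒xy≢0 b∧c = *-nonzero (b⇒x≢0 (∧-conicalˡ b c b∧c)) (c⇒y≢0 (∧-conicalʳ b c b∧c))

  indicator : Bool → ℝ
  indicator true  = 1ℝ
  indicator false = 0ℝ

  indicator-nonneg : ∀ b → 0ℝ ≤ indicator b
  indicator-nonneg true  = inj₁ 0<1
  indicator-nonneg false = inj₂ refl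

  NonzeroIff-indicator : ∀ b → NonzeroIff (indicator b) b
  NonzeroIff-indicator true  = (λ _ → refl) , (λ _ 1≡0 → 0≢1 (sym 1≡0))
  NonzeroIff-indicator false = (λ 0≢0 → ⊥-elim (0≢0 refl)) , (λ ())

  NonzeroIff-indicator-* : ∀ b {y} → (b ≡ true → y ≢ 0ℝ) → NonzeroIff (indicator b * y) b
  NonzeroIff-indicator-* true  {y} y≢0 =
    (λ _ → refl) , (λ _ 1*y≡0 → y≢0 refl (trans (sym (*-identityˡ y)) 1*y≡0))
  NonzeroIff-indicator-* false {y} _   = (λ 0*y≢0 → ⊥-elim (0*y≢0 (zeroˡ y))) , (λ ())

  δ : ∀ {m} → Fin m → Fin m → ℝ
  δ i j = indicator ⌊ i ≟ j ⌋

  δ-refl : ∀ {m} (i : Fin m) → δ i i ≡ 1ℝ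
  δ-refl i with i ≟ i
  ... | yes _  = refl
  ... | no i≢i = ⊥-elim (i≢i refl)

  δ-≢ : ∀ {m} {i j : Fin m} → i ≢ j → δ i j ≡ 0ℝ
  δ-≢ {i = i} {j} i≢j with i ≟ j
  ... | yes i≡j = ⊥-elim (i≢j i≡j)
  ... | no _    = refl

  δ-sym : ∀ {m} (i j : Fin m) → δ i j ≡ δ j i
  δ-sym i j with i ≟ j | j ≟ i
  ... | yes _   | yes _   = refl
  ... | no _    | no _    = refl
  ... | yes i≡j | no j≢i  = ⊥-elim (j≢i (sym i≡j))
  ... | no i≢j  | yes j≡i = ⊥-elim (i≢j (sym j≡i))

  Σ-δˡ : ∀ {m} (i : Fin m) (f : Fin m → ℝ) → Σℝ R (λ j → δ i j * f j) ≡ f i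
  Σ-δˡ i f =
    trans (Σ-single i (λ j j≢i → trans (cong (_* f j) (δ-≢ (λ i≡j → j≢i (sym i≡j)))) (zeroˡ (f j))))
          (trans (cong (_* f i) (δ-refl i)) (*-identityˡ (f i)))

  Σ-δʳ : ∀ {m} (i : Fin m) (f : Fin m → ℝ) → Σℝ R (λ j → f j * δ j i) ≡ f i
  Σ-δʳ i f = trans (Σ-cong (λ j → trans (*-comm (f j) (δ j i)) (cong (_* f j) (δ-sym j i)))) (Σ-δˡ i f)

  _·_ : ∀ {k} → ℝ → Matrix R k → Matrix R k
  (c · M) i j = c * M i j

  scalarMatrix : ∀ {k} → ℝ → Matrix R k
  scalarMatrix c = c · δ

  mmul-· : ∀ {k} a b (M N : Matrix R k) i j → mmul R (a · M) (b · N) i j ≡ a * b * mmul R M N i j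
  mmul-· a b M N i j =
    trans (Σ-cong (λ s → rearrange a b (M i s) (N s j))) (sym (*-distribˡ-Σ (a * b) (λ s → M i s * N s j)))
    where
    rearrange : ∀ a b x y → a * x * (b * y) ≡ a * b * (x * y)
    rearrange = solve 4 (λ a b x y → a :* x :* (b :* y) := a :* b :* (x :* y)) refl

  mmul-scalarMatrixˡ : ∀ {k} c (M : Matrix R k) i j → mmul R (scalarMatrix c) M i j ≡ c * M i j
  mmul-scalarMatrixˡ c M i j =
    trans (Σ-cong (λ s → *-assoc c (δ i s) (M s j)))
          (trans (sym (*-distribˡ-Σ c (λ s → δ i s * M s j))) (cong (c *_) (Σ-δˡ i (λ s → M s j))))

  mmul-scalarMatrixʳ : ∀ {k} c (M : Matrix R k) i j → mmul R M (scalarMatrix c) i j ≡ c * M i j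
  mmul-scalarMatrixʳ c M i j =
    trans (Σ-cong (λ s → trans (sym (*-assoc (M i s) c (δ s j)))
                               (trans (cong (_* δ s j) (*-comm (M i s) c)) (*-assoc c (M i s) (δ s j)))))
          (trans (sym (*-distribˡ-Σ c (λ s → M i s * δ s j))) (cong (c *_) (Σ-δʳ j (M i))))

  blockMatrix : ∀ {m k} → (Fin m → Fin m → Matrix R k) → Matrix R (m ℕ.* k)
  blockMatrix {m} {k} F p q = F (quotient {m} k p) (quotient {m} k q) (remainder {m} k p) (remainder {m} k q)

  blockMatrix-combine : ∀ {m k} (F : Fin m → Fin m → Matrix R k) u v (a b : Fin k) →
                        blockMatrix F (combine u a) (combine v b) ≡ F u v a b
  blockMatrix-combine F u v a b =
    cong₂ (λ (ua vb : _ × _) → F (proj₁ ua) (proj₁ vb) (proj₂ ua) (proj₂ vb))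
          (remQuot-combine u a) (remQuot-combine v b)

  mmul-blockMatrix : ∀ {m k} (F F′ : Fin m → Fin m → Matrix R k) p q →
    mmul R (blockMatrix F) (blockMatrix F′) p q
      ≡ Σℝ R (λ v → mmul R (F (quotient {m} k p) v) (F′ v (quotient {m} k q))
                                 (remainder {m} k p) (remainder {m} k q))
  mmul-blockMatrix {m} {k} F F′ p q =
    Σ-remQuot m (λ (v , b) → F (quotient {m} k p) v (remainder {m} k p) b
                             * F′ v (quotient {m} k q) b (remainder {m} k q))

  mmul-scaledBlocks : ∀ {m k} (a b : Matrix R m) (P Q : Fin m → Fin m → Matrix R k) (S : Matrix R k) →
    (∀ u v w i j → mmul R (P u v) (Q v w) i j ≡ S i j) → ∀ p q →
    mmul R (blockMatrix (λ u v → a u v · P u v)) (blockMatrix (λ u v → b u v · Q u v)) p q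
      ≡ mmul R a b (quotient {m} k p) (quotient {m} k q) * S (remainder {m} k p) (remainder {m} k q)
  mmul-scaledBlocks {m} {k} a b P Q S PQ≡S p q = begin
    mmul R (blockMatrix (λ u v → a u v · P u v)) (blockMatrix (λ u v → b u v · Q u v)) p q
      ≡⟨ mmul-blockMatrix {m} {k} (λ u v → a u v · P u v) (λ u v → b u v · Q u v) p q ⟩
    Σℝ R (λ v → mmul R (a u v · P u v) (b v w · Q v w) i j)
      ≡⟨ Σ-cong (λ v → trans (mmul-· (a u v) (b v w) (P u v) (Q v w) i j)
                             (cong (a u v * b v w *_) (PQ≡S u v w i j))) ⟩
    Σℝ R (λ v → a u v * b v w * S i j)
      ≡⟨ sym (*-distribʳ-Σ (S i j) (λ v → a u v * b v w)) ⟩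
    mmul R a b u w * S i j
      ∎
    where
    open ≡-Reasoning
    u w : Fin m
    u = quotient {m} k p
    w = quotient {m} k q
    i j : Fin k
    i = remainder {m} k p
    j = remainder {m} k q

  splitAt-injective : ∀ m {n} {p q : Fin (m ℕ.+ n)} → splitAt m p ≡ splitAt m q → p ≡ q
  splitAt-injective m {n} {p} {q} eq =
    trans (sym (join-splitAt m n p)) (trans (cong (join m n) eq) (join-splitAt m n q))

  remQuot-injective : ∀ {m} k {p q : Fin (m ℕ.* k)} → remQuot {m} k p ≡ remQuot k q → p ≡ q
  remQuot-injective {m} k {p} {q} eq =
    trans (sym (combine-remQuot {m} k p)) (trans (cong (uncurry combine) eq) (combine-remQuot {m} k q))

  -- Tensor products

  WeightedAdjacency : (H : Graph) → Matrix R (n H) → Set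
  WeightedAdjacency H B = Symmetric R B × (∀ r s → NonzeroIff (B r s) (adj H r s))

  Eigenpair : ∀ {k} → Matrix R k → (Fin k → ℝ) → ℝ → Set
  Eigenpair B x c = ∀ r → Σℝ R (λ s → B r s * x s) ≡ c * x r

  module TensorLift (G H : Graph) {B : Matrix R (n H)} {x : Fin (n H) → ℝ} {c : ℝ}
                    (B-weighted : WeightedAdjacency H B) (eigen : Eigenpair B x c) where

    projG : Fin (n G ℕ.* n H) → Fin (n G)
    projG = quotient (n H)

    projH : Fin (n G ℕ.* n H) → Fin (n H)
    projH = remainder {n G} (n H)

    C : Matrix R (n H)
    C a b = x a * x b

    K : Fin (n G) → Fin (n G) → Matrix R (n H)
    K u v = if ⌊ u ≟ v ⌋ then scalarMatrix c else B

    K-sym : ∀ u v a b → K u v a b ≡ K v u b a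
    K-sym u v a b with u ≟ v | v ≟ u
    ... | yes _   | yes _   = cong (c *_) (δ-sym a b)
    ... | no _    | no _    = proj₁ B-weighted a b
    ... | yes u≡v | no v≢u  = ⊥-elim (v≢u (sym u≡v))
    ... | no u≢v  | yes v≡u = ⊥-elim (u≢v (sym v≡u))

    BC≡cC : ∀ a b → mmul R B C a b ≡ c * C a b
    BC≡cC a b = begin
      Σℝ R (λ s → B a s * (x s * x b))  ≡⟨ Σ-cong (λ s → sym (*-assoc (B a s) (x s) (x b))) ⟩
      Σℝ R (λ s → B a s * x s * x b)    ≡⟨ sym (*-distribʳ-Σ (x b) (λ s → B a s * x s)) ⟩
      Σℝ R (λ s → B a s * x s) * x b    ≡⟨ cong (_* x b) (eigen a) ⟩
      c * x a * x b                     ≡⟨ *-assoc c (x a) (x b) ⟩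
      c * (x a * x b)                   ∎
      where open ≡-Reasoning

    CB≡cC : ∀ a b → mmul R C B a b ≡ c * C a b
    CB≡cC a b = begin
      Σℝ R (λ s → x a * x s * B s b)    ≡⟨ Σ-cong (λ s → trans (*-assoc (x a) (x s) (B s b))
                                                   (cong (x a *_) (trans (*-comm (x s) (B s b))
                                                                         (cong (_* x s) (proj₁ B-weighted s b))))) ⟩
      Σℝ R (λ s → x a * (B b s * x s))  ≡⟨ sym (*-distribˡ-Σ (x a) (λ s → B b s * x s)) ⟩
      x a * Σℝ R (λ s → B b s * x s)    ≡⟨ cong (x a *_) (eigen b) ⟩
      x a * (c * x b)                   ≡⟨ sym (*-assoc (x a) c (x b)) ⟩
      x a * c * x b                     ≡⟨ cong (_* x b) (*-comm (x a) c) ⟩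
      c * x a * x b                     ≡⟨ *-assoc c (x a) (x b) ⟩
      c * (x a * x b)                   ∎
      where open ≡-Reasoning

    KC≡cC : ∀ u v a b → mmul R (K u v) C a b ≡ c * C a b
    KC≡cC u v a b with u ≟ v
    ... | yes _ = mmul-scalarMatrixˡ c C a b
    ... | no _  = BC≡cC a b

    CK≡cC : ∀ u v a b → mmul R C (K u v) a b ≡ c * C a b
    CK≡cC u v a b with u ≟ v
    ... | yes _ = mmul-scalarMatrixʳ c C a b
    ... | no _  = CB≡cC a b

    liftMatrix : Matrix R (n G) → Matrix R (n G ℕ.* n H)
    liftMatrix A = blockMatrix (λ u v → A u v · K u v)

    liftWitness : Matrix R (n G) → Matrix R (n G ℕ.* n H)
    liftWitness X = blockMatrix (λ u v → X u v · C)

    liftMatrix-InS : ∀ {A} → InS R G A → InS R (tensor G H) (liftMatrix A)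
    liftMatrix-InS {A} (A-sym , A-pattern) =
      (λ p q → cong₂ _*_ (A-sym (projG p) (projG q)) (K-sym (projG p) (projG q) (projH p) (projH q))) ,
      (λ p q p≢q → entry-pattern (λ remQuot≡ → p≢q (remQuot-injective (n H) remQuot≡)))
      where
      entry-pattern : ∀ {u v a b} → (u , a) ≢ (v , b) → NonzeroIff (A u v * K u v a b) (adj G u v ∧ adj H a b)
      entry-pattern {u} {v} {a} {b} ua≢vb with u ≟ v
      ... | no u≢v  = NonzeroIff-* (A-pattern u v u≢v) (proj₂ B-weighted a b)
      ... | yes refl =
        subst₂ NonzeroIff (sym entry≡0) (sym (cong (_∧ adj H a b) (adj-irr G u))) (NonzeroIff-indicator false)
        where
        entry≡0 : A u u * (c * δ a b) ≡ 0ℝ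
        entry≡0 = trans (cong (λ d → A u u * (c * d)) (δ-≢ (λ a≡b → ua≢vb (cong (u ,_) a≡b))))
                        (trans (cong (A u u *_) (zeroʳ c)) (zeroʳ (A u u)))

    liftWitness-sym : ∀ {X} → Symmetric R X → Symmetric R (liftWitness X)
    liftWitness-sym X-sym p q = cong₂ _*_ (X-sym (projG p) (projG q)) (*-comm (x (projH p)) (x (projH q)))

    liftWitness-diagonal : ∀ {X : Matrix R (n G)} → (∀ i → X i i ≡ 0ℝ) → ∀ p → liftWitness X p p ≡ 0ℝ
    liftWitness-diagonal X-diagonal p = trans (cong (_* C (projH p) (projH p)) (X-diagonal (projG p))) (zeroˡ _)

    lift-orthogonal : ∀ {A X : Matrix R (n G)} → (∀ i j → A i j * X i j ≡ 0ℝ) →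
                      ∀ p q → liftMatrix A p q * liftWitness X p q ≡ 0ℝ
    lift-orthogonal {A} {X} A∘X≡0 p q =
      trans (interchange (A u v) (K u v a b) (X u v) (C a b))
            (trans (cong (_* (K u v a b * C a b)) (A∘X≡0 u v)) (zeroˡ _))
      where
      u v : Fin (n G)
      u = projG p
      v = projG q
      a b : Fin (n H)
      a = projH p
      b = projH q
      interchange : ∀ α κ ξ γ → α * κ * (ξ * γ) ≡ α * ξ * (κ * γ)
      interchange = solve 4 (λ α κ ξ γ → α :* κ :* (ξ :* γ) := α :* ξ :* (κ :* γ)) refl

    lift-commute : ∀ {A X : Matrix R (n G)} → (∀ i j → mmul R A X i j ≡ mmul R X A i j) →
                   ∀ p q → mmul R (liftMatrix A) (liftWitness X) p q ≡ mmul R (liftWitness X) (liftMatrix A) p q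
    lift-commute {A} {X} AX≡XA p q =
      trans (mmul-scaledBlocks A X K (λ _ _ → C) (c · C) (λ u v _ → KC≡cC u v) p q)
            (trans (cong (_* (c · C) (projH p) (projH q)) (AX≡XA (projG p) (projG q)))
                   (sym (mmul-scaledBlocks X A (λ _ _ → C) K (c · C) (λ _ v w → CK≡cC v w) p q)))

    tensor-reflects-GSSP : InGSSP R (tensor G H) → (w : Fin (n H)) → x w ≢ 0ℝ → InGSSP R G
    tensor-reflects-GSSP G×H-SSP w xw≢0 A A∈S X X-sym A∘X≡0 X-diagonal AX≡XA i j =
      *≡0⇒≡0 (trans (sym (blockMatrix-combine (λ u v → X u v · C) i j w w))
                    (G×H-SSP (liftMatrix A) (liftMatrix-InS A∈S) (liftWitness X) (liftWitness-sym X-sym)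
                             (lift-orthogonal A∘X≡0) (liftWitness-diagonal {X} X-diagonal) (lift-commute AX≡XA)
                             (combine i w) (combine j w)))
             (*-nonzero xw≢0 xw≢0)

  -- D^(1/2) 1 vanishes at isolated vertices (where recip inverts nothing), so an isolated vertex w needs
  -- the eigenvector e_w, for the eigenvalue 0, instead.
  module NormalizedAdjacency (H : Graph) where

    degree : Fin (n H) → ℝ
    degree r = Σℝ R (λ s → indicator (adj H r s))

    degree-nonneg : ∀ r → 0ℝ ≤ degree r
    degree-nonneg r = Σ-nonneg (λ s → indicator-nonneg (adj H r s))

    √degree : Fin (n H) → ℝ
    √degree r = proj₁ (sqrt (degree-nonneg r))

    √degree² : ∀ r → √degree r * √degree r ≡ degree r
    √degree² r = proj₂ (sqrt (degree-nonneg r))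

    √degree-nonzero : ∀ {r s} → adj H r s ≡ true → √degree r ≢ 0ℝ
    √degree-nonzero {r} {s} rs∈E √deg≡0 = 0<⇒≢0 0<degree degree≡0
      where
      0<degree : 0ℝ < degree r
      0<degree = Σ-pos (λ t → indicator-nonneg (adj H r t)) s (subst (λ b → 0ℝ < indicator b) (sym rs∈E) 0<1)
      degree≡0 : degree r ≡ 0ℝ
      degree≡0 = trans (sym (√degree² r)) (trans (cong (_* √degree r) √deg≡0) (zeroˡ _))

    B : Matrix R (n H)
    B r s = indicator (adj H r s) * (recip (√degree r) * recip (√degree s))

    B-weighted : WeightedAdjacency H B
    B-weighted = B-sym , λ r s → NonzeroIff-indicator-* (adj H r s) (λ rs∈E →
      *-nonzero (recip-nonzero (√degree-nonzero rs∈E))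
                (recip-nonzero (√degree-nonzero (trans (adj-sym H s r) rs∈E))))
      where
      B-sym : Symmetric R B
      B-sym r s = cong₂ _*_ (cong indicator (adj-sym H r s)) (*-comm _ _)

    B-term : ∀ r s → B r s * √degree s ≡ recip (√degree r) * indicator (adj H r s)
    B-term r s with adj H r s in rs∈E
    ... | true  = begin
      1ℝ * (recip (√degree r) * recip (√degree s)) * √degree s
        ≡⟨ cong (_* √degree s) (*-identityˡ _) ⟩
      recip (√degree r) * recip (√degree s) * √degree s
        ≡⟨ *-assoc _ _ _ ⟩
      recip (√degree r) * (recip (√degree s) * √degree s)
        ≡⟨ cong (recip (√degree r) *_)
                (trans (*-comm _ _) (recip-inverse (√degree-nonzero (trans (adj-sym H s r) rs∈E)))) ⟩
      recip (√degree r) * 1ℝ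
        ∎
      where open ≡-Reasoning
    ... | false = trans (cong (_* √degree s) (zeroˡ _)) (trans (zeroˡ _) (sym (zeroʳ _)))

    eigenpair-√degree : Eigenpair B √degree 1ℝ
    eigenpair-√degree r = begin
      Σℝ R (λ s → B r s * √degree s)
        ≡⟨ Σ-cong (B-term r) ⟩
      Σℝ R (λ s → recip (√degree r) * indicator (adj H r s))
        ≡⟨ sym (*-distribˡ-Σ (recip (√degree r)) (λ s → indicator (adj H r s))) ⟩
      recip (√degree r) * degree r
        ≡⟨ cong (recip (√degree r) *_) (sym (√degree² r)) ⟩
      recip (√degree r) * (√degree r * √degree r)
        ≡⟨ cancel (√degree r ≟ℝ 0ℝ) ⟩
      √degree r
        ≡⟨ sym (*-identityˡ _) ⟩
      1ℝ * √degree r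
        ∎
      where
      open ≡-Reasoning
      cancel : Dec (√degree r ≡ 0ℝ) → recip (√degree r) * (√degree r * √degree r) ≡ √degree r
      cancel (yes √deg≡0) =
        trans (cong (λ y → recip (√degree r) * (y * y)) √deg≡0)
              (trans (trans (cong (recip (√degree r) *_) (zeroˡ 0ℝ)) (zeroʳ _)) (sym √deg≡0))
      cancel (no √deg≢0) =
        trans (sym (*-assoc _ _ _))
              (trans (cong (_* √degree r) (trans (*-comm _ _) (recip-inverse √deg≢0))) (*-identityˡ _))

    eigenpair-isolated : ∀ w → (∀ r → adj H r w ≡ false) → Eigenpair B (λ s → δ s w) 0ℝ
    eigenpair-isolated w isolated r =
      trans (Σ-δʳ w (B r))
            (trans (cong (λ b → indicator b * (recip (√degree r) * recip (√degree w))) (isolated r))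
                   (trans (zeroˡ _) (sym (zeroˡ _))))

    √degree≡0⇒isolated : ∀ {w} → √degree w ≡ 0ℝ → ∀ r → adj H r w ≡ false
    √degree≡0⇒isolated {w} √deg≡0 r with adj H r w in rw∈E
    ... | true  = ⊥-elim (√degree-nonzero (trans (adj-sym H w r) rw∈E) √deg≡0)
    ... | false = refl

    weightedAdjacency-eigenpair : (w : Fin (n H)) →
      Σ (Matrix R (n H)) λ B → Σ (Fin (n H) → ℝ) λ x → Σ ℝ λ c →
        WeightedAdjacency H B × Eigenpair B x c × x w ≢ 0ℝ
    weightedAdjacency-eigenpair w with √degree w ≟ℝ 0ℝ
    ... | no √deg≢0  = B , √degree , 1ℝ , B-weighted , eigenpair-√degree , √deg≢0
    ... | yes √deg≡0 = B , (λ s → δ s w) , 0ℝ , B-weighted , eigenpair-isolated w (√degree≡0⇒isolated √deg≡0) ,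
                       (λ δww≡0 → 0≢1 (trans (sym δww≡0) (δ-refl w)))

  -- Coronas with edgeless graphs

  Σ-δ-remQuot : ∀ {m k} (i : Fin m) (a : Fin k) (f : Fin m → ℝ) →
    Σℝ R (λ e → δ i (quotient {m} k e) * δ (remainder {m} k e) a * f (quotient {m} k e)) ≡ f i
  Σ-δ-remQuot {m} {k} i a f = begin
    Σℝ R (λ e → δ i (quotient {m} k e) * δ (remainder {m} k e) a * f (quotient {m} k e))
      ≡⟨ Σ-remQuot m (λ (l , b) → δ i l * δ b a * f l) ⟩
    Σℝ R (λ l → Σℝ R (λ b → δ i l * δ b a * f l))
      ≡⟨ Σ-cong (λ l → trans (Σ-cong (λ b → swap₂₃ (δ i l) (δ b a) (f l))) (Σ-δʳ a (λ _ → δ i l * f l))) ⟩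
    Σℝ R (λ l → δ i l * f l)
      ≡⟨ Σ-δˡ i f ⟩
    f i ∎
    where
    open ≡-Reasoning
    swap₂₃ : ∀ x y z → x * y * z ≡ x * z * y
    swap₂₃ = solve 3 (λ x y z → x :* y :* z := x :* z :* y) refl

  module CoronaLift (G : Graph) (k : ℕ) where

    Vertex : Set
    Vertex = Fin (n G) ⊎ Fin (n G ℕ.* k)

    owner : Fin (n G ℕ.* k) → Fin (n G)
    owner = quotient k

    copy : Fin (n G ℕ.* k) → Fin k
    copy = remainder {n G} k

    onSplit : (Vertex → Vertex → ℝ) → Matrix R (n G ℕ.+ n G ℕ.* k)
    onSplit M p q = M (splitAt (n G) p) (splitAt (n G) q)

    mmul⊎ : (Vertex → Vertex → ℝ) → (Vertex → Vertex → ℝ) → Vertex → Vertex → ℝ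
    mmul⊎ M M′ y z = Σℝ R (λ i → M y (inj₁ i) * M′ (inj₁ i) z) + Σℝ R (λ d → M y (inj₂ d) * M′ (inj₂ d) z)

    mmul-onSplit : ∀ M M′ p q →
                   mmul R (onSplit M) (onSplit M′) p q ≡ mmul⊎ M M′ (splitAt (n G) p) (splitAt (n G) q)
    mmul-onSplit M M′ p q = Σ-splitAt-⊎ (n G) (λ y → M (splitAt (n G) p) y * M′ y (splitAt (n G) q))

    liftMatrix : Matrix R (n G) → Vertex → Vertex → ℝ
    liftMatrix A (inj₁ i) (inj₁ j) = A i j
    liftMatrix A (inj₁ i) (inj₂ d) = δ i (owner d)
    liftMatrix A (inj₂ c) (inj₁ j) = δ (owner c) j
    liftMatrix A (inj₂ c) (inj₂ d) = 0ℝ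

    pendantWitness : Matrix R (n G) → Matrix R (n G ℕ.* k)
    pendantWitness X c d = X (owner c) (owner d) * δ (copy c) (copy d)

    liftWitness : Matrix R (n G) → Vertex → Vertex → ℝ
    liftWitness X (inj₁ i) (inj₁ j) = X i j
    liftWitness X (inj₁ i) (inj₂ d) = 0ℝ
    liftWitness X (inj₂ c) (inj₁ j) = 0ℝ
    liftWitness X (inj₂ c) (inj₂ d) = pendantWitness X c d

    liftMatrix-InS : ∀ {A} → InS R G A → InS R (corona G (edgeless k)) (onSplit (liftMatrix A))
    liftMatrix-InS {A} (A-sym , A-pattern) =
      (λ p q → lift-sym (splitAt (n G) p) (splitAt (n G) q)) ,
      (λ p q p≢q → lift-pattern (splitAt (n G) p) (splitAt (n G) q) (λ eq → p≢q (splitAt-injective (n G) eq)))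
      where
      lift-sym : ∀ y z → liftMatrix A y z ≡ liftMatrix A z y
      lift-sym (inj₁ i) (inj₁ j) = A-sym i j
      lift-sym (inj₁ i) (inj₂ d) = δ-sym i (owner d)
      lift-sym (inj₂ c) (inj₁ j) = δ-sym (owner c) j
      lift-sym (inj₂ c) (inj₂ d) = refl
      lift-pattern : ∀ y z → y ≢ z → NonzeroIff (liftMatrix A y z) (coronaAdj' G (edgeless k) y z)
      lift-pattern (inj₁ i) (inj₁ j) i≢j = A-pattern i j (λ i≡j → i≢j (cong inj₁ i≡j))
      lift-pattern (inj₁ i) (inj₂ d) _   = NonzeroIff-indicator _
      lift-pattern (inj₂ c) (inj₁ j) _   = NonzeroIff-indicator _
      lift-pattern (inj₂ c) (inj₂ d) _   = subst (NonzeroIff 0ℝ) (sym (∧-zeroʳ _)) (NonzeroIff-indicator false)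

    liftWitness-sym : ∀ {X} → Symmetric R X → ∀ y z → liftWitness X y z ≡ liftWitness X z y
    liftWitness-sym X-sym (inj₁ i) (inj₁ j) = X-sym i j
    liftWitness-sym X-sym (inj₁ i) (inj₂ d) = refl
    liftWitness-sym X-sym (inj₂ c) (inj₁ j) = refl
    liftWitness-sym X-sym (inj₂ c) (inj₂ d) = cong₂ _*_ (X-sym (owner c) (owner d)) (δ-sym (copy c) (copy d))

    liftWitness-diagonal : ∀ {X : Matrix R (n G)} → (∀ i → X i i ≡ 0ℝ) → ∀ y → liftWitness X y y ≡ 0ℝ
    liftWitness-diagonal X-diagonal (inj₁ i) = X-diagonal i
    liftWitness-diagonal X-diagonal (inj₂ c) =
      trans (cong (_* δ (copy c) (copy c)) (X-diagonal (owner c))) (zeroˡ _)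

    lift-orthogonal : ∀ {A X : Matrix R (n G)} → (∀ i j → A i j * X i j ≡ 0ℝ) →
                      ∀ y z → liftMatrix A y z * liftWitness X y z ≡ 0ℝ
    lift-orthogonal A∘X≡0 (inj₁ i) (inj₁ j) = A∘X≡0 i j
    lift-orthogonal A∘X≡0 (inj₁ i) (inj₂ d) = zeroʳ _
    lift-orthogonal A∘X≡0 (inj₂ c) (inj₁ j) = zeroʳ _
    lift-orthogonal A∘X≡0 (inj₂ c) (inj₂ d) = zeroˡ _

    incidence-pendantWitness : ∀ X i d → Σℝ R (λ e → δ i (owner e) * pendantWitness X e d) ≡ X i (owner d)
    incidence-pendantWitness X i d =
      trans (Σ-cong (λ e → reorder (δ i (owner e)) (X (owner e) (owner d)) (δ (copy e) (copy d))))
            (Σ-δ-remQuot i (copy d) (λ l → X l (owner d)))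
      where
      reorder : ∀ x y z → x * (y * z) ≡ x * z * y
      reorder = solve 3 (λ x y z → x :* (y :* z) := x :* z :* y) refl

    pendantWitness-incidence : ∀ X c j → Σℝ R (λ e → pendantWitness X c e * δ (owner e) j) ≡ X (owner c) j
    pendantWitness-incidence X c j =
      trans (Σ-cong (λ e → trans (reorder (X (owner c) (owner e)) (δ (copy c) (copy e)) (δ (owner e) j))
                                 (cong₂ (λ δ₁ δ₂ → δ₁ * δ₂ * X (owner c) (owner e))
                                        (δ-sym (owner e) j) (δ-sym (copy c) (copy e)))))
            (Σ-δ-remQuot j (copy c) (X (owner c)))
      where
      reorder : ∀ x y z → x * y * z ≡ z * y * x
      reorder = solve 3 (λ x y z → x :* y :* z := z :* y :* x) refl

    lift-commute : ∀ {A X : Matrix R (n G)} → (∀ i j → mmul R A X i j ≡ mmul R X A i j) →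
                   ∀ y z → mmul⊎ (liftMatrix A) (liftWitness X) y z ≡ mmul⊎ (liftWitness X) (liftMatrix A) y z
    lift-commute AX≡XA (inj₁ i) (inj₁ j) =
      cong₂ _+_ (AX≡XA i j)
                (trans (Σ-zero (λ d → zeroʳ (δ i (owner d)))) (sym (Σ-zero (λ d → zeroˡ (δ (owner d) j)))))
    lift-commute {A} {X} _ (inj₁ i) (inj₂ d) = begin
      Σℝ R (λ l → A i l * 0ℝ) + Σℝ R (λ e → δ i (owner e) * pendantWitness X e d)
        ≡⟨ cong₂ _+_ (Σ-zero (λ l → zeroʳ (A i l))) (incidence-pendantWitness X i d) ⟩
      0ℝ + X i (owner d)
        ≡⟨ +-comm 0ℝ (X i (owner d)) ⟩
      X i (owner d) + 0ℝ
        ≡⟨ sym (cong₂ _+_ (Σ-δʳ (owner d) (X i)) (Σ-zero {n G ℕ.* k} (λ _ → zeroˡ 0ℝ))) ⟩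
      Σℝ R (λ l → X i l * δ l (owner d)) + Σℝ R {n G ℕ.* k} (λ _ → 0ℝ * 0ℝ)
        ∎
      where open ≡-Reasoning
    lift-commute {A} {X} _ (inj₂ c) (inj₁ j) = begin
      Σℝ R (λ l → δ (owner c) l * X l j) + Σℝ R {n G ℕ.* k} (λ _ → 0ℝ * 0ℝ)
        ≡⟨ cong₂ _+_ (Σ-δˡ (owner c) (λ l → X l j)) (Σ-zero {n G ℕ.* k} (λ _ → zeroˡ 0ℝ)) ⟩
      X (owner c) j + 0ℝ
        ≡⟨ +-comm (X (owner c) j) 0ℝ ⟩
      0ℝ + X (owner c) j
        ≡⟨ sym (cong₂ _+_ (Σ-zero (λ l → zeroˡ (A l j))) (pendantWitness-incidence X c j)) ⟩
      Σℝ R (λ l → 0ℝ * A l j) + Σℝ R (λ e → pendantWitness X c e * δ (owner e) j)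
        ∎
      where open ≡-Reasoning
    lift-commute {X = X} AX≡XA (inj₂ c) (inj₂ d) =
      trans (cong₂ _+_ (Σ-zero (λ l → zeroʳ (δ (owner c) l))) (Σ-zero (λ e → zeroˡ (pendantWitness X e d))))
            (sym (cong₂ _+_ (Σ-zero (λ l → zeroˡ (δ l (owner d)))) (Σ-zero (λ e → zeroʳ (pendantWitness X c e)))))

    corona-reflects-GSSP : InGSSP R (corona G (edgeless k)) → InGSSP R G
    corona-reflects-GSSP G⊙K-SSP A A∈S X X-sym A∘X≡0 X-diagonal AX≡XA i j =
      trans (sym (cong₂ (liftWitness X) (splitAt-↑ˡ (n G) i (n G ℕ.* k)) (splitAt-↑ˡ (n G) j (n G ℕ.* k))))
            (G⊙K-SSP (onSplit (liftMatrix A)) (liftMatrix-InS A∈S) (onSplit (liftWitness X))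
                     (λ p q → liftWitness-sym X-sym (splitAt (n G) p) (splitAt (n G) q))
                     (λ p q → lift-orthogonal A∘X≡0 (splitAt (n G) p) (splitAt (n G) q))
                     (λ p → liftWitness-diagonal {X} X-diagonal (splitAt (n G) p))
                     (λ p q → trans (mmul-onSplit (liftMatrix A) (liftWitness X) p q)
                                    (trans (lift-commute AX≡XA (splitAt (n G) p) (splitAt (n G) q))
                                           (sym (mmul-onSplit (liftWitness X) (liftMatrix A) p q))))
                     (i ↑ˡ n G ℕ.* k) (j ↑ˡ n G ℕ.* k))

open import Data.Nat using (_≤_)

corollary2p3 : (R : RealField) (G : Graph) → ¬ InGSSP R G →
    ((H : Graph) → 1 ≤ n H → ¬ InGSSP R (tensor G H))
    × ((m : ℕ) → 1 ≤ m → ¬ InGSSP R (corona G (edgeless (m ∸ 1))))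
corollary2p3 R G G∉GSSP = tensor-case , corona-case
  where
  tensor-case : (H : Graph) → 1 ≤ n H → ¬ InGSSP R (tensor G H)
  tensor-case H 1≤n G×H∈GSSP with NormalizedAdjacency.weightedAdjacency-eigenpair R H (fromℕ< 1≤n)
  ... | B , x , c , B-weighted , eigen , x≢0 =
    G∉GSSP (TensorLift.tensor-reflects-GSSP R G H B-weighted eigen G×H∈GSSP (fromℕ< 1≤n) x≢0)
  corona-case : (m : ℕ) → 1 ≤ m → ¬ InGSSP R (corona G (edgeless (m ∸ 1)))
  corona-case m _ G⊙K∈GSSP = G∉GSSP (CoronaLift.corona-reflects-GSSP R G (m ∸ 1) G⊙K∈GSSP)
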